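{- Let $H=(V,E)$ be a bipartite $n$-node graph whose nodes are partitioned into $L$ layers $V_1,\dots,V_L$ such that every edge of $E$ joins two adjacent layers $V_i$ and $V_{i+1}$ for some $i\in\{1,\dots,L-1\}$. A top-down path is a path of length $L-1$ containing exactly one node from each layer $V_i$. If each node knows its layer, there is a deterministic $O(L^2)$-round $\mathsf{CONGEST}$ algorithm that computes, for every $v\in V$ and every $e\in E$, the number of top-down paths passing through $v$ and through $e$.
   Context: $\mathsf{CONGEST}$ model: network is $H$; unique $O(\log n)$-bit IDs; synchronous rounds in which each node can send an $O(\log n)$-bit message to each neighbor; local computation free. At the end, each node knows the count for itself and for its incident edges. -}

module Defs where

open import Data.Nat using (ℕ; zero; suc; _+_; _*_; _^_; _<_; _≡ᵇ_)
open import Data.Nat.Logarithm using (⌊log₂_⌋)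
open import Data.Fin using (Fin; toℕ; _≟_)
open import Data.Bool using (Bool; true; false; _∧_; _∨_; if_then_else_)
open import Data.List using (List; []; _∷_; map; filter; length; concatMap; allFin; take; concat)
open import Data.Vec using (Vec; []; _∷_)
open import Data.Sum using (_⊎_)
open import Relation.Binary.PropositionalEquality using (_≡_)
open import Relation.Nullary.Decidable using (⌊_⌋)
open import Relation.Nullary using (yes; no)
open import Data.Bool.Properties using () renaming (_≟_ to _≟B_)

record SimpleGraph (n : ℕ) : Set where
  field
    adj   : Fin n → Fin n → Bool
    sym   : ∀ u v → adj u v ≡ adj v u
    irrfl : ∀ v → adj v v ≡ false

-- A layering into L layers V_1..V_L (represented 0-based as Fin L) such that
-- every edge joins two adjacent layers.
IsLayering : ∀ {n} → SimpleGraph n → (L : ℕ) → (Fin n → Fin L) → Set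
IsLayering {n} G L layer =
  ∀ (u v : Fin n) → SimpleGraph.adj G u v ≡ true →
    (suc (toℕ (layer u)) ≡ toℕ (layer v)) ⊎ (suc (toℕ (layer v)) ≡ toℕ (layer u))

module Paths {n : ℕ} (G : SimpleGraph n) {L : ℕ} (layer : Fin n → Fin L) where
  open SimpleGraph G

  eqF : Fin n → Fin n → Bool
  eqF x y = ⌊ x ≟ y ⌋

  allVecs : (k : ℕ) → List (Vec (Fin n) k)
  allVecs zero = [] ∷ []
  allVecs (suc k) = concatMap (λ x → map (x ∷_) (allVecs k)) (allFin n)

  tdFrom : ∀ {k} → ℕ → Vec (Fin n) k → Bool
  tdFrom i [] = true
  tdFrom i (x ∷ []) = toℕ (layer x) ≡ᵇ i
  tdFrom i (x ∷ y ∷ xs) = (toℕ (layer x) ≡ᵇ i) ∧ (adj x y ∧ tdFrom (suc i) (y ∷ xs))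

  isTopDown : Vec (Fin n) L → Bool
  isTopDown p = tdFrom 0 p

  nodeIn : ∀ {k} → Fin n → Vec (Fin n) k → Bool
  nodeIn v [] = false
  nodeIn v (x ∷ xs) = eqF x v ∨ nodeIn v xs

  edgeIn : ∀ {k} → Fin n → Fin n → Vec (Fin n) k → Bool
  edgeIn u v [] = false
  edgeIn u v (x ∷ []) = false
  edgeIn u v (x ∷ y ∷ xs) =
    ((eqF x u ∧ eqF y v) ∨ (eqF x v ∧ eqF y u)) ∨ edgeIn u v (y ∷ xs)

  topDownPaths : List (Vec (Fin n) L)
  topDownPaths = filter (λ p → isTopDown p ≟B true) (allVecs L)

  countNode : Fin n → ℕ
  countNode v = length (filter (λ p → nodeIn v p ≟B true) topDownPaths)

  countEdge : Fin n → Fin n → ℕ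
  countEdge u v = length (filter (λ p → edgeIn u v p ≟B true) topDownPaths)

-- Local computation is free (arbitrary
-- state type and functions). A node initially knows n, L, its own ID, its
-- layer (0-based), and the IDs of its neighbours. In each round it sends a
-- bit string to each neighbour (addressed by ID); it then updates its state
-- from the received messages (a function from sender ID to message; the empty
-- string for non-neighbours). Outputs: a count for the node, and a count for
-- each incident edge, addressed by the neighbour's ID.
record Algorithm : Set₁ where
  field
    State   : Set
    init    : (n L myId myLayer : ℕ) → List ℕ → State
    send    : State → ℕ → List Bool
    receive : State → (ℕ → List Bool) → State
    outNode : State → ℕ
    outEdge : State → ℕ → ℕ

-- Execution on a network. Bandwidth b bits: each message is truncated to
-- its first b bits, so at most b bits cross an edge per direction per round.
module Run (A : Algorithm) {n : ℕ} (G : SimpleGraph n) (L : ℕ)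
           (layer : Fin n → Fin L) (ident : Fin n → ℕ) (b : ℕ) where
  open Algorithm A
  open SimpleGraph G

  neighbours : Fin n → List (Fin n)
  neighbours v = filter (λ u → adj v u ≟B true) (allFin n)

  state : ℕ → Fin n → State
  state zero v = init n L (ident v) (toℕ (layer v)) (map ident (neighbours v))
  state (suc t) v = receive (state t v) inbox
    where
      inbox : ℕ → List Bool
      inbox j = concat (map (λ u → if ident u ≡ᵇ j then take b (send (state t u) (ident v)) else [])
                             (neighbours v))

bandwidth : ℕ → ℕ → ℕ
bandwidth c n = c * suc ⌊log₂ n ⌋

{-# OPTIONS --safe #-}

-- A top-down path through v is a path from the first layer to v glued to a path from v to the
-- last layer, so there are up v * down v of them, where up v and down v count these two halves;
-- an edge from u to the next layer's v lies on up u * down v of them.  Both counts obey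
-- layer-by-layer recurrences over neighbours: up from the layer above, down from the layer below.
-- The algorithm runs in phases of L rounds.  In a phase every node transmits its layer and its
-- current estimates of up and down, each number in L * (1 + ⌊log₂ n⌋) bits (enough, as the counts
-- are at most n ^ (L - 1)) split into L chunks, and then recomputes its estimates from what it
-- heard.  After p phases the up-estimates are exact on layers ≤ p, the down-estimates on layers
-- ≥ L - 1 - p, and both are 0 elsewhere; so after L phases, i.e. L² rounds, all outputs are exact.

module Submission where

open import Defs
open import Data.Nat using (ℕ; suc; _*_; _^_; _<_)
open import Data.Fin using (Fin; toℕ)
open import Data.Bool using (true)
open import Data.Product using (∃; _×_)
open import Function.Definitions using (Injective)
open import Relation.Binary.PropositionalEquality using (_≡_)

open import Data.Nat using (zero; _+_; _≤_; _∸_; _≡ᵇ_; _≤ᵇ_; _≤?_; z≤n; s≤s)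
open import Data.Nat.Properties
open import Data.Nat.ListAction using () renaming (sum to listSum)
open import Data.Nat.DivMod using (_/_; _%_; m≡m%n+[m/n]*n; m%n<n; m<n*o⇒m/o<n; m*n/n≡m; /-monoˡ-≤)
open import Data.Nat.Logarithm using (⌊log₂_⌋; ⌊log₂⌋-mono-≤; ⌊log₂[2^n]⌋≡n)
open import Data.Fin using () renaming (zero to fzero; suc to fsuc)
open import Data.Fin.Properties using (toℕ<n; ¬Fin0) renaming (_≟_ to _≟ᶠ_; suc-injective to fsuc-injective)
open import Data.Bool using (Bool; false; _∧_; _∨_; if_then_else_; T)
open import Data.Bool.Properties using (∧-conicalˡ; ∧-conicalʳ; ∧-zeroʳ; ∨-comm; ¬-not) renaming (_≟_ to _≟ᵇ_)
open import Data.List.Properties using (map-cong; map-∘; length-++; ++-identityʳ; take-take; take-all)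
open import Data.Vec using (Vec; []; _∷_)
open import Data.List using (List; []; _∷_; _++_; map; filter; length; concat; concatMap; allFin; tabulate; take; drop)
open import Data.Product using (_,_; proj₁; proj₂)
open import Data.Empty using (⊥-elim)
open import Data.Sum using (_⊎_; inj₁; inj₂; [_,_]′)
open import Function using (_∘_)
open import Relation.Nullary using (¬_; Dec; yes; no)
open import Relation.Nullary.Decidable using (⌊_⌋; dec-true; dec-false; isYes≗does)
open import Relation.Binary.PropositionalEquality
  using (refl; sym; trans; cong; cong₂; subst; module ≡-Reasoning)
open import Algebra.Properties.Semiring.Sum +-*-semiring
  using (sum; sum-syntax; ∑-comm; *-distribˡ-sum; *-distribʳ-sum; sum-cong-≗; sum-replicate-zero)

⟦_⟧ : Bool → ℕ
⟦ true ⟧ = 1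
⟦ false ⟧ = 0

⟦∧⟧ : ∀ a b → ⟦ a ∧ b ⟧ ≡ ⟦ a ⟧ * ⟦ b ⟧
⟦∧⟧ true b = sym (+-identityʳ ⟦ b ⟧)
⟦∧⟧ false b = refl

⟦⟧≤1 : ∀ a → ⟦ a ⟧ ≤ 1
⟦⟧≤1 true = ≤-refl
⟦⟧≤1 false = z≤n

≡ᵇ-true : ∀ {m n} → m ≡ n → (m ≡ᵇ n) ≡ true
≡ᵇ-true {m} {n} = dec-true (m ≟ n)

≡ᵇ-false : ∀ {m n} → ¬ m ≡ n → (m ≡ᵇ n) ≡ false
≡ᵇ-false {m} {n} = dec-false (m ≟ n)

≤ᵇ-true : ∀ {m n} → m ≤ n → (m ≤ᵇ n) ≡ true
≤ᵇ-true {m} {n} = dec-true (m ≤? n)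

≤ᵇ-false : ∀ {m n} → ¬ m ≤ n → (m ≤ᵇ n) ≡ false
≤ᵇ-false {m} {n} = dec-false (m ≤? n)

guard-cong : ∀ c {x y} → (c ≡ true → x ≡ y) → ⟦ c ⟧ * x ≡ ⟦ c ⟧ * y
guard-cong true eq = cong (1 *_) (eq refl)
guard-cong false eq = refl

⌊≟⌋-true : ∀ {k} {x y : Fin k} → x ≡ y → ⌊ x ≟ᶠ y ⌋ ≡ true
⌊≟⌋-true {x = x} {y} eq = trans (isYes≗does (x ≟ᶠ y)) (dec-true (x ≟ᶠ y) eq)

⌊≟⌋-false : ∀ {k} {x y : Fin k} → ¬ x ≡ y → ⌊ x ≟ᶠ y ⌋ ≡ false
⌊≟⌋-false {x = x} {y} ne = trans (isYes≗does (x ≟ᶠ y)) (dec-false (x ≟ᶠ y) ne)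

∨-true : ∀ a {b} → a ∨ b ≡ true → a ≡ true ⊎ b ≡ true
∨-true true _ = inj₁ refl
∨-true false e = inj₂ e

∨-trueˡ : ∀ {a} b → a ≡ true → a ∨ b ≡ true
∨-trueˡ b refl = refl

∨-trueʳ : ∀ a {b} → b ≡ true → a ∨ b ≡ true
∨-trueʳ true _ = refl
∨-trueʳ false e = e

⌊≟⌋-sound : ∀ {k} (x y : Fin k) → ⌊ x ≟ᶠ y ⌋ ≡ true → x ≡ y
⌊≟⌋-sound x y e with x ≟ᶠ y
... | yes x≡y = x≡y
⌊≟⌋-sound x y () | no _

∑-zero : ∀ {n} (f : Fin n → ℕ) → (∀ i → f i ≡ 0) → sum f ≡ 0
∑-zero {n} f eq = trans (sum-cong-≗ eq) (sum-replicate-zero n)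

∑-single : ∀ {n} (f : Fin n → ℕ) (j : Fin n) → (∀ i → ¬ i ≡ j → f i ≡ 0) → sum f ≡ f j
∑-single f fzero vanish =
  trans (cong (f fzero +_) (∑-zero _ (λ i → vanish (fsuc i) λ ()))) (+-identityʳ _)
∑-single f (fsuc j) vanish =
  trans (cong (_+ sum (λ i → f (fsuc i))) (vanish fzero λ ()))
        (∑-single (λ i → f (fsuc i)) j (λ i ne → vanish (fsuc i) (λ eq → ne (fsuc-injective eq))))

∑-δˡ : ∀ {n} (x : Fin n) (f : Fin n → ℕ) → ∑[ y < n ] (⟦ ⌊ x ≟ᶠ y ⌋ ⟧ * f y) ≡ f x
∑-δˡ {n} x f = begin
  ∑[ y < n ] (⟦ ⌊ x ≟ᶠ y ⌋ ⟧ * f y)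
    ≡⟨ ∑-single _ x (λ y y≢x → cong (λ b → ⟦ b ⟧ * f y) (⌊≟⌋-false (y≢x ∘ sym))) ⟩
  ⟦ ⌊ x ≟ᶠ x ⌋ ⟧ * f x             ≡⟨ cong (λ b → ⟦ b ⟧ * f x) (⌊≟⌋-true {x = x} refl) ⟩
  1 * f x                          ≡⟨ *-identityˡ (f x) ⟩
  f x                              ∎
  where open ≡-Reasoning

∑-δʳ : ∀ {n} (f : Fin n → ℕ) (z : Fin n) → ∑[ y < n ] (f y * ⟦ ⌊ y ≟ᶠ z ⌋ ⟧) ≡ f z
∑-δʳ {n} f z = begin
  ∑[ y < n ] (f y * ⟦ ⌊ y ≟ᶠ z ⌋ ⟧)
    ≡⟨ ∑-single _ z (λ y y≢z → trans (cong (λ b → f y * ⟦ b ⟧) (⌊≟⌋-false y≢z)) (*-zeroʳ (f y))) ⟩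
  f z * ⟦ ⌊ z ≟ᶠ z ⌋ ⟧             ≡⟨ cong (λ b → f z * ⟦ b ⟧) (⌊≟⌋-true {x = z} refl) ⟩
  f z * 1                          ≡⟨ *-identityʳ (f z) ⟩
  f z                              ∎
  where open ≡-Reasoning

∑-mono-≤ : ∀ {n} (f : Fin n → ℕ) {B} → (∀ i → f i ≤ B) → sum f ≤ n * B
∑-mono-≤ {zero} f le = z≤n
∑-mono-≤ {suc n} f le = +-mono-≤ (le fzero) (∑-mono-≤ (λ i → f (fsuc i)) (λ i → le (fsuc i)))

∑-*-interchange : ∀ {m n} (f : Fin m → ℕ) (A : Fin m → Fin n → ℕ) (g : Fin n → ℕ) →
  ∑[ y < n ] (∑[ x < m ] (f x * A x y) * g y) ≡ ∑[ x < m ] (f x * ∑[ y < n ] (A x y * g y))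
∑-*-interchange {m} {n} f A g = begin
  ∑[ y < n ] (∑[ x < m ] (f x * A x y) * g y)   ≡⟨ sum-cong-≗ (λ y → *-distribʳ-sum (g y) (λ x → f x * A x y)) ⟩
  ∑[ y < n ] ∑[ x < m ] (f x * A x y * g y)     ≡⟨ ∑-comm (λ y x → f x * A x y * g y) ⟩
  ∑[ x < m ] ∑[ y < n ] (f x * A x y * g y)     ≡⟨ sum-cong-≗ (λ x → sum-cong-≗ (λ y → *-assoc (f x) (A x y) (g y))) ⟩
  ∑[ x < m ] ∑[ y < n ] (f x * (A x y * g y))   ≡⟨ sum-cong-≗ (λ x → *-distribˡ-sum (f x) (λ y → A x y * g y)) ⟨
  ∑[ x < m ] (f x * ∑[ y < n ] (A x y * g y))   ∎
  where open ≡-Reasoning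

sum-map-++ : ∀ {A : Set} (f : A → ℕ) xs ys → listSum (map f (xs ++ ys)) ≡ listSum (map f xs) + listSum (map f ys)
sum-map-++ f [] ys = refl
sum-map-++ f (x ∷ xs) ys = trans (cong (f x +_) (sum-map-++ f xs ys)) (sym (+-assoc (f x) _ _))

sum-map-concatMap : ∀ {A B : Set} (f : B → ℕ) (g : A → List B) xs →
  listSum (map f (concatMap g xs)) ≡ listSum (map (λ x → listSum (map f (g x))) xs)
sum-map-concatMap f g [] = refl
sum-map-concatMap f g (x ∷ xs) =
  trans (sum-map-++ f (g x) (concatMap g xs)) (cong (listSum (map f (g x)) +_) (sum-map-concatMap f g xs))

sum-map-filter : ∀ {A : Set} (P : A → Bool) (f : A → ℕ) xs →
  listSum (map f (filter (λ x → P x ≟ᵇ true) xs)) ≡ listSum (map (λ x → ⟦ P x ⟧ * f x) xs)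
sum-map-filter P f [] = refl
sum-map-filter P f (x ∷ xs) with P x
... | true = cong₂ _+_ (sym (+-identityʳ (f x))) (sum-map-filter P f xs)
... | false = sum-map-filter P f xs

length-filter : ∀ {A : Set} (P : A → Bool) xs →
  length (filter (λ x → P x ≟ᵇ true) xs) ≡ listSum (map (λ x → ⟦ P x ⟧) xs)
length-filter P [] = refl
length-filter P (x ∷ xs) with P x
... | true = cong suc (length-filter P xs)
... | false = length-filter P xs

sum-map-tabulate : ∀ {A : Set} {n} (f : A → ℕ) (g : Fin n → A) → listSum (map f (tabulate g)) ≡ ∑[ i < n ] f (g i)
sum-map-tabulate {n = zero} f g = refl
sum-map-tabulate {n = suc n} f g = cong (f (g fzero) +_) (sum-map-tabulate f (λ i → g (fsuc i)))

sum-map-allFin : ∀ {n} (f : Fin n → ℕ) → listSum (map f (allFin n)) ≡ sum f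
sum-map-allFin f = sum-map-tabulate f (λ i → i)

concat-map-filter : ∀ {A B : Set} (P : A → Bool) (F : A → List B) xs →
  concat (map F (filter (λ x → P x ≟ᵇ true) xs)) ≡ concat (map (λ x → if P x then F x else []) xs)
concat-map-filter P F [] = refl
concat-map-filter P F (x ∷ xs) with P x
... | true = cong (F x ++_) (concat-map-filter P F xs)
... | false = concat-map-filter P F xs

concat-map-tabulate-[] : ∀ {A B : Set} {m} (F : A → List B) (g : Fin m → A) → (∀ i → F (g i) ≡ []) →
  concat (map F (tabulate g)) ≡ []
concat-map-tabulate-[] {m = zero} F g empty = refl
concat-map-tabulate-[] {m = suc m} F g empty
  rewrite empty fzero = concat-map-tabulate-[] F (λ i → g (fsuc i)) (λ i → empty (fsuc i))

concat-map-tabulate-single : ∀ {A B : Set} {m} (F : A → List B) (g : Fin m → A) (j : Fin m) →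
  (∀ i → ¬ i ≡ j → F (g i) ≡ []) → concat (map F (tabulate g)) ≡ F (g j)
concat-map-tabulate-single F g fzero off
  rewrite concat-map-tabulate-[] F (λ i → g (fsuc i)) (λ i → off (fsuc i) λ ()) = ++-identityʳ (F (g fzero))
concat-map-tabulate-single F g (fsuc j) off
  rewrite off fzero (λ ()) = concat-map-tabulate-single F (λ i → g (fsuc i)) j (λ i ne → off (fsuc i) (ne ∘ fsuc-injective))

sum-map-*ˡ : ∀ {A : Set} (c : ℕ) (f : A → ℕ) xs → listSum (map (λ x → c * f x) xs) ≡ c * listSum (map f xs)
sum-map-*ˡ c f [] = sym (*-zeroʳ c)
sum-map-*ˡ c f (x ∷ xs) = trans (cong (c * f x +_) (sum-map-*ˡ c f xs)) (sym (*-distribˡ-+ c (f x) _))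

-- Counting top-down paths

module Walks {n : ℕ} (G : SimpleGraph n) {h : ℕ} (layer : Fin n → Fin (suc h)) where
  open SimpleGraph G using (adj) renaming (sym to adj-sym)
  open Paths G layer

  ℓ : Fin n → ℕ
  ℓ x = toℕ (layer x)

  step : ℕ → Fin n → Fin n → ℕ
  step i x y = ⟦ (ℓ x ≡ᵇ i) ∧ adj x y ⟧

  walksFrom : ℕ → Fin n → (len : ℕ) → (Vec (Fin n) (suc len) → Bool) → ℕ
  walksFrom i x len Q = listSum (map (λ xs → ⟦ tdFrom i (x ∷ xs) ∧ Q (x ∷ xs) ⟧) (allVecs len))

  pathsFrom : ℕ → Fin n → ℕ → ℕ
  pathsFrom i x len = walksFrom i x len (λ _ → true)

  sum-allVecs-suc : ∀ len (f : Vec (Fin n) (suc len) → ℕ) →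
    listSum (map f (allVecs (suc len))) ≡ ∑[ y < n ] listSum (map (λ ys → f (y ∷ ys)) (allVecs len))
  sum-allVecs-suc len f = begin
    listSum (map f (allVecs (suc len)))
      ≡⟨ sum-map-concatMap f (λ y → map (y ∷_) (allVecs len)) (allFin n) ⟩
    listSum (map (λ y → listSum (map f (map (y ∷_) (allVecs len)))) (allFin n))
      ≡⟨ sum-map-allFin {n} _ ⟩
    ∑[ y < n ] listSum (map f (map (y ∷_) (allVecs len)))
      ≡⟨ sum-cong-≗ {n} (λ y → cong listSum (map-∘ (allVecs len))) ⟨
    ∑[ y < n ] listSum (map (λ ys → f (y ∷ ys)) (allVecs len)) ∎
    where open ≡-Reasoning

  walksFrom-zero : ∀ i x Q → walksFrom i x 0 Q ≡ ⟦ (ℓ x ≡ᵇ i) ∧ Q (x ∷ []) ⟧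
  walksFrom-zero i x Q = +-identityʳ _

  walksFrom-suc : ∀ i x len Q →
    walksFrom i x (suc len) Q ≡ ∑[ y < n ] (step i x y * walksFrom (suc i) y len (λ p → Q (x ∷ p)))
  walksFrom-suc i x len Q =
    trans (sum-allVecs-suc len _) (sum-cong-≗ λ y →
      trans (cong listSum (map-cong (λ _ → factor (ℓ x ≡ᵇ i) (adj x y)) (allVecs len)))
            (sum-map-*ˡ (step i x y) _ (allVecs len)))
    where
    factor : ∀ a b {c d} → ⟦ (a ∧ (b ∧ c)) ∧ d ⟧ ≡ ⟦ a ∧ b ⟧ * ⟦ c ∧ d ⟧
    factor true true = sym (+-identityʳ _)
    factor true false = refl
    factor false b = refl

  walksFrom-cong : ∀ i x len Q R → (∀ xs → tdFrom i (x ∷ xs) ≡ true → Q (x ∷ xs) ≡ R (x ∷ xs)) →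
    walksFrom i x len Q ≡ walksFrom i x len R
  walksFrom-cong i x len Q R eq = cong listSum (map-cong pointwise (allVecs len))
    where
    pointwise : ∀ xs → ⟦ tdFrom i (x ∷ xs) ∧ _ ⟧ ≡ ⟦ tdFrom i (x ∷ xs) ∧ _ ⟧
    pointwise xs with tdFrom i (x ∷ xs) in td
    ... | true = cong ⟦_⟧ (eq xs td)
    ... | false = refl

  walksFrom-false : ∀ i x len → walksFrom i x len (λ _ → false) ≡ 0
  walksFrom-false i x len = sum-map-zero (allVecs len)
    where
    sum-map-zero : ∀ xss → listSum (map (λ xs → ⟦ tdFrom i (x ∷ xs) ∧ false ⟧) xss) ≡ 0
    sum-map-zero [] = refl
    sum-map-zero (xs ∷ xss) rewrite ∧-zeroʳ (tdFrom i (x ∷ xs)) = sum-map-zero xss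

  step-*-cong : ∀ i x y {a b} → (ℓ x ≡ i → a ≡ b) → step i x y * a ≡ step i x y * b
  step-*-cong i x y eq with ℓ x ≟ i
  ... | yes ℓx≡i = cong (step i x y *_) (eq ℓx≡i)
  ... | no ℓx≢i rewrite ≡ᵇ-false ℓx≢i = refl

  td-head : ∀ {len} i x (xs : Vec (Fin n) len) → tdFrom i (x ∷ xs) ≡ true → ℓ x ≡ i
  td-head i x [] td = ≡ᵇ⇒≡ (ℓ x) i (subst T (sym td) _)
  td-head i x (y ∷ ys) td = ≡ᵇ⇒≡ (ℓ x) i (subst T (sym (∧-conicalˡ _ _ td)) _)

  td-tail : ∀ {len} i x y (ys : Vec (Fin n) len) → tdFrom i (x ∷ y ∷ ys) ≡ true → tdFrom (suc i) (y ∷ ys) ≡ true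
  td-tail i x y ys td = ∧-conicalʳ (adj x y) _ (∧-conicalʳ (ℓ x ≡ᵇ i) _ td)

  td-avoids : ∀ {len} i (xs : Vec (Fin n) len) v → ℓ v < i → tdFrom i xs ≡ true → nodeIn v xs ≡ false
  td-avoids-tail : ∀ {len} i x (xs : Vec (Fin n) len) v → ℓ v ≤ i → tdFrom i (x ∷ xs) ≡ true → nodeIn v xs ≡ false

  td-avoids i [] v lt td = refl
  td-avoids i (x ∷ xs) v lt td = cong₂ _∨_ (⌊≟⌋-false x≢v) (td-avoids-tail i x xs v (<⇒≤ lt) td)
    where
    x≢v : ¬ x ≡ v
    x≢v refl = <⇒≢ lt (td-head i x xs td)

  td-avoids-tail i x [] v le td = refl
  td-avoids-tail i x (y ∷ ys) v le td = td-avoids (suc i) (y ∷ ys) v (s≤s le) (td-tail i x y ys td)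

  edgeIn⇒nodeIn : ∀ {len} a b (xs : Vec (Fin n) len) → edgeIn a b xs ≡ true → nodeIn a xs ≡ true
  edgeIn⇒nodeIn a b (x ∷ y ∷ ys) e =
    [ [ (λ ab → ∨-trueˡ _ (∧-conicalˡ (eqF x a) (eqF y b) ab))
      , (λ ba → ∨-trueʳ (eqF x a) (∨-trueˡ _ (∧-conicalʳ (eqF x b) (eqF y a) ba))) ]′ ∘ ∨-true (eqF x a ∧ eqF y b)
    , (λ rest → ∨-trueʳ (eqF x a) (edgeIn⇒nodeIn a b (y ∷ ys) rest)) ]′
    (∨-true ((eqF x a ∧ eqF y b) ∨ (eqF x b ∧ eqF y a)) e)

  edgeIn-tail : ∀ {len} a b x y (ys : Vec (Fin n) len) → ¬ (x ≡ a × y ≡ b) →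
    edgeIn a b (x ∷ y ∷ ys) ≡ true → nodeIn a (y ∷ ys) ≡ true
  edgeIn-tail a b x y ys ¬ab e with ∨-true ((eqF x a ∧ eqF y b) ∨ (eqF x b ∧ eqF y a)) e
  ... | inj₂ rest = edgeIn⇒nodeIn a b (y ∷ ys) rest
  ... | inj₁ here with ∨-true (eqF x a ∧ eqF y b) here
  ...   | inj₁ ab = ⊥-elim (¬ab ( ⌊≟⌋-sound x a (∧-conicalˡ (eqF x a) (eqF y b) ab)
                               , ⌊≟⌋-sound y b (∧-conicalʳ (eqF x a) (eqF y b) ab)))
  ...   | inj₂ ba = ∨-trueˡ (nodeIn a ys) (∧-conicalʳ (eqF x b) (eqF y a) ba)

  -- The (x, z) entry of the matrix product step i · step (i + 1) ⋯ step (i + d - 1).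
  walksBetween : ℕ → ℕ → Fin n → Fin n → ℕ
  walksBetween i zero x z = ⟦ eqF x z ⟧
  walksBetween i (suc d) x z = ∑[ y < n ] (step i x y * walksBetween (suc i) d y z)

  walksBetween-snoc : ∀ i d x z → walksBetween i (suc d) x z ≡ ∑[ y < n ] (walksBetween i d x y * step (d + i) y z)
  walksBetween-snoc i zero x z = trans (∑-δʳ (step i x) z) (sym (∑-δˡ x (λ y → step i y z)))
  walksBetween-snoc i (suc d) x z = begin
    ∑[ y < n ] (step i x y * walksBetween (suc i) (suc d) y z)
      ≡⟨ sum-cong-≗ (λ y → cong (step i x y *_) (walksBetween-snoc (suc i) d y z)) ⟩
    ∑[ y < n ] (step i x y * ∑[ w < n ] (walksBetween (suc i) d y w * step (d + suc i) w z))
      ≡⟨ ∑-*-interchange (step i x) (walksBetween (suc i) d) (λ w → step (d + suc i) w z) ⟨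
    ∑[ w < n ] (walksBetween i (suc d) x w * step (d + suc i) w z)
      ≡⟨ sum-cong-≗ (λ w → cong (λ j → walksBetween i (suc d) x w * step j w z) (+-suc d i)) ⟩
    ∑[ w < n ] (walksBetween i (suc d) x w * step (suc d + i) w z) ∎
    where open ≡-Reasoning

  walksBetween-suc-* : ∀ i d x z c → ∑[ y < n ] (step i x y * (walksBetween (suc i) d y z * c)) ≡ walksBetween i (suc d) x z * c
  walksBetween-suc-* i d x z c = trans (sum-cong-≗ (λ y → sym (*-assoc (step i x y) _ c)))
                                (sym (*-distribʳ-sum c (λ y → step i x y * walksBetween (suc i) d y z)))

  walksBetween-layer : ∀ i d x z → ℓ z ≡ d + i → ⟦ ℓ x ≡ᵇ i ⟧ * walksBetween i d x z ≡ walksBetween i d x z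
  walksBetween-layer i zero x z ℓz≡i with x ≟ᶠ z
  ... | yes refl rewrite ≡ᵇ-true ℓz≡i = +-identityʳ _
  ... | no _ = *-zeroʳ ⟦ ℓ x ≡ᵇ i ⟧
  walksBetween-layer i (suc d) x z _ =
    trans (*-distribˡ-sum ⟦ ℓ x ≡ᵇ i ⟧ (λ y → step i x y * walksBetween (suc i) d y z)) (sum-cong-≗ λ y →
    trans (sym (*-assoc ⟦ ℓ x ≡ᵇ i ⟧ (step i x y) _)) (cong (_* walksBetween (suc i) d y z) (idem (ℓ x ≡ᵇ i) (adj x y))))
    where
    idem : ∀ a b → ⟦ a ⟧ * ⟦ a ∧ b ⟧ ≡ ⟦ a ∧ b ⟧
    idem true b = +-identityʳ ⟦ b ⟧
    idem false b = refl

  pathsTo : ℕ → Fin n → ℕ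
  pathsTo zero v = ⟦ ℓ v ≡ᵇ 0 ⟧
  pathsTo (suc m) v = ∑[ u < n ] (pathsTo m u * step m u v)

  pathsTo≡∑walksBetween : ∀ d v → pathsTo d v ≡ ∑[ x < n ] (⟦ ℓ x ≡ᵇ 0 ⟧ * walksBetween 0 d x v)
  pathsTo≡∑walksBetween zero v = sym (∑-δʳ (λ x → ⟦ ℓ x ≡ᵇ 0 ⟧) v)
  pathsTo≡∑walksBetween (suc d) v = begin
    ∑[ u < n ] (pathsTo d u * step d u v)
      ≡⟨ sum-cong-≗ (λ u → cong (_* step d u v) (pathsTo≡∑walksBetween d u)) ⟩
    ∑[ u < n ] (∑[ x < n ] (⟦ ℓ x ≡ᵇ 0 ⟧ * walksBetween 0 d x u) * step d u v)
      ≡⟨ ∑-*-interchange (λ x → ⟦ ℓ x ≡ᵇ 0 ⟧) (walksBetween 0 d) (λ u → step d u v) ⟩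
    ∑[ x < n ] (⟦ ℓ x ≡ᵇ 0 ⟧ * ∑[ u < n ] (walksBetween 0 d x u * step d u v))
      ≡⟨ sum-cong-≗ (λ x → cong (λ j → ⟦ ℓ x ≡ᵇ 0 ⟧ * ∑[ u < n ] (walksBetween 0 d x u * step j u v))
                               (sym (+-identityʳ d))) ⟩
    ∑[ x < n ] (⟦ ℓ x ≡ᵇ 0 ⟧ * ∑[ u < n ] (walksBetween 0 d x u * step (d + 0) u v))
      ≡⟨ sum-cong-≗ (λ x → cong (⟦ ℓ x ≡ᵇ 0 ⟧ *_) (walksBetween-snoc 0 d x v)) ⟨
    ∑[ x < n ] (⟦ ℓ x ≡ᵇ 0 ⟧ * walksBetween 0 (suc d) x v) ∎
    where open ≡-Reasoning

  up : Fin n → ℕ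
  up v = pathsTo (ℓ v) v

  down : Fin n → ℕ
  down v = pathsFrom (ℓ v) v (h ∸ ℓ v)

  ℓ≤h : ∀ v → ℓ v ≤ h
  ℓ≤h v = ≤-pred (toℕ<n (layer v))

  up≡∑walksBetween : ∀ v → up v ≡ ∑[ x < n ] walksBetween 0 (ℓ v) x v
  up≡∑walksBetween v = trans (pathsTo≡∑walksBetween (ℓ v) v)
                             (sum-cong-≗ λ x → walksBetween-layer 0 (ℓ v) x v (sym (+-identityʳ (ℓ v))))

  walksFrom-nodeIn : ∀ d i x len v → ℓ v ≡ d + i → d ≤ len →
    walksFrom i x len (nodeIn v) ≡ walksBetween i d x v * pathsFrom (ℓ v) v (len ∸ d)
  walksFrom-nodeIn zero i x len v ℓv≡i _ = through (x ≟ᶠ v)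
    where
    open ≡-Reasoning
    through : Dec (x ≡ v) → walksFrom i x len (nodeIn v) ≡ ⟦ eqF x v ⟧ * pathsFrom (ℓ v) v len
    through (yes refl) = begin
      walksFrom i x len (nodeIn x)
        ≡⟨ walksFrom-cong i x len (nodeIn x) (λ _ → true) (λ xs _ → ∨-trueˡ (nodeIn x xs) (⌊≟⌋-true {x = x} refl)) ⟩
      pathsFrom i x len             ≡⟨ cong (λ j → pathsFrom j x len) ℓv≡i ⟨
      pathsFrom (ℓ x) x len         ≡⟨ +-identityʳ _ ⟨
      1 * pathsFrom (ℓ x) x len     ≡⟨ cong (λ c → ⟦ c ⟧ * pathsFrom (ℓ x) x len) (⌊≟⌋-true {x = x} refl) ⟨
      ⟦ eqF x x ⟧ * pathsFrom (ℓ x) x len ∎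
    through (no x≢v) = begin
      walksFrom i x len (nodeIn v)  ≡⟨ walksFrom-cong i x len (nodeIn v) (λ _ → false) misses ⟩
      walksFrom i x len (λ _ → false) ≡⟨ walksFrom-false i x len ⟩
      0                              ≡⟨ cong (λ c → ⟦ c ⟧ * pathsFrom (ℓ v) v len) (⌊≟⌋-false x≢v) ⟨
      ⟦ eqF x v ⟧ * pathsFrom (ℓ v) v len ∎
      where
      misses : ∀ xs → tdFrom i (x ∷ xs) ≡ true → nodeIn v (x ∷ xs) ≡ false
      misses xs td = cong₂ _∨_ (⌊≟⌋-false x≢v) (td-avoids-tail i x xs v (≤-reflexive ℓv≡i) td)
  walksFrom-nodeIn (suc d) i x (suc len) v ℓv≡ (s≤s d≤len) = begin
    walksFrom i x (suc len) (nodeIn v)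
      ≡⟨ walksFrom-suc i x len (nodeIn v) ⟩
    ∑[ y < n ] (step i x y * walksFrom (suc i) y len (λ p → eqF x v ∨ nodeIn v p))
      ≡⟨ sum-cong-≗ (λ y → step-*-cong i x y λ ℓx≡i →
           trans (walksFrom-cong (suc i) y len (λ p → eqF x v ∨ nodeIn v p) (nodeIn v)
                                 (λ xs _ → cong (_∨ nodeIn v (y ∷ xs)) (⌊≟⌋-false (x≢v ℓx≡i))))
                 (walksFrom-nodeIn d (suc i) y len v (trans ℓv≡ (sym (+-suc d i))) d≤len)) ⟩
    ∑[ y < n ] (step i x y * (walksBetween (suc i) d y v * pathsFrom (ℓ v) v (len ∸ d)))
      ≡⟨ walksBetween-suc-* i d x v _ ⟩
    walksBetween i (suc d) x v * pathsFrom (ℓ v) v (len ∸ d) ∎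
    where
    open ≡-Reasoning
    x≢v : ℓ x ≡ i → ¬ x ≡ v
    x≢v ℓx≡i refl = m≢1+n+m i (trans (sym ℓx≡i) ℓv≡)

  walksFrom-edgeIn-missed : ∀ a b x y j len → ¬ (x ≡ a × y ≡ b) → ℓ a < j →
    walksFrom j y len (λ p → edgeIn a b (x ∷ p)) ≡ 0
  walksFrom-edgeIn-missed a b x y j len ¬ab ℓa<j =
    trans (walksFrom-cong j y len (λ p → edgeIn a b (x ∷ p)) (λ _ → false) (λ ys td → ¬-not λ e →
             true≢false (trans (sym (edgeIn-tail a b x y ys ¬ab e)) (td-avoids j (y ∷ ys) a ℓa<j td))))
          (walksFrom-false j y len)
    where
    true≢false : ¬ true ≡ false
    true≢false ()

  walksFrom-edgeIn : ∀ d i x len a b → adj a b ≡ true → ℓ b ≡ suc (ℓ a) → ℓ a ≡ d + i → d < len →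
    walksFrom i x len (edgeIn a b) ≡ walksBetween i d x a * pathsFrom (ℓ b) b (len ∸ suc d)
  walksFrom-edgeIn zero i x (suc len) a b ab ℓb≡ ℓa≡i _ =
    trans (walksFrom-suc i x len (edgeIn a b)) (along (x ≟ᶠ a))
    where
    open ≡-Reasoning
    ℓa<1+i : ℓ a < suc i
    ℓa<1+i = ≤-reflexive (cong suc ℓa≡i)
    along : Dec (x ≡ a) → ∑[ y < n ] (step i x y * walksFrom (suc i) y len (λ p → edgeIn a b (x ∷ p)))
                          ≡ ⟦ eqF x a ⟧ * pathsFrom (ℓ b) b len
    along (no x≢a) = begin
      ∑[ y < n ] (step i x y * walksFrom (suc i) y len (λ p → edgeIn a b (x ∷ p)))
        ≡⟨ ∑-zero _ (λ y → trans (cong (step i x y *_)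
                                        (walksFrom-edgeIn-missed a b x y (suc i) len (λ (x≡a , _) → x≢a x≡a) ℓa<1+i))
                                 (*-zeroʳ (step i x y))) ⟩
      0 ≡⟨ cong (λ c → ⟦ c ⟧ * pathsFrom (ℓ b) b len) (⌊≟⌋-false x≢a) ⟨
      ⟦ eqF x a ⟧ * pathsFrom (ℓ b) b len ∎
    along (yes refl) = begin
      ∑[ y < n ] (step i x y * walksFrom (suc i) y len (λ p → edgeIn x b (x ∷ p)))
        ≡⟨ ∑-single _ b (λ y y≢b →
             trans (cong (step i x y *_) (walksFrom-edgeIn-missed x b x y (suc i) len (λ (_ , y≡b) → y≢b y≡b) ℓa<1+i))
                   (*-zeroʳ (step i x y))) ⟩
      step i x b * walksFrom (suc i) b len (λ p → edgeIn x b (x ∷ p))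
        ≡⟨ cong₂ _*_ (cong₂ (λ c e → ⟦ c ∧ e ⟧) (≡ᵇ-true ℓa≡i) ab)
                     (walksFrom-cong (suc i) b len (λ p → edgeIn x b (x ∷ p)) (λ _ → true)
                                     (λ ys _ → ∨-trueˡ _ (∨-trueˡ _ here))) ⟩
      1 * pathsFrom (suc i) b len
        ≡⟨ cong₂ (λ c j → ⟦ c ⟧ * pathsFrom j b len) (⌊≟⌋-true {x = x} refl) (trans ℓb≡ (cong suc ℓa≡i)) ⟨
      ⟦ eqF x x ⟧ * pathsFrom (ℓ b) b len ∎
      where
      here : (eqF x x ∧ eqF b b) ≡ true
      here = cong₂ _∧_ (⌊≟⌋-true {x = x} refl) (⌊≟⌋-true {x = b} refl)
  walksFrom-edgeIn (suc d) i x (suc len) a b ab ℓb≡ ℓa≡ (s≤s d<len) = begin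
    walksFrom i x (suc len) (edgeIn a b)
      ≡⟨ walksFrom-suc i x len (edgeIn a b) ⟩
    ∑[ y < n ] (step i x y * walksFrom (suc i) y len (λ p → edgeIn a b (x ∷ p)))
      ≡⟨ sum-cong-≗ (λ y → step-*-cong i x y λ ℓx≡i →
           trans (walksFrom-cong (suc i) y len (λ p → edgeIn a b (x ∷ p)) (edgeIn a b) (λ ys _ → skip y ys ℓx≡i))
                 (walksFrom-edgeIn d (suc i) y len a b ab ℓb≡ (trans ℓa≡ (sym (+-suc d i))) d<len)) ⟩
    ∑[ y < n ] (step i x y * (walksBetween (suc i) d y a * pathsFrom (ℓ b) b (len ∸ suc d)))
      ≡⟨ walksBetween-suc-* i d x a _ ⟩
    walksBetween i (suc d) x a * pathsFrom (ℓ b) b (len ∸ suc d) ∎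
    where
    open ≡-Reasoning
    skip : ∀ {len} y (ys : Vec (Fin n) len) → ℓ x ≡ i → edgeIn a b (x ∷ y ∷ ys) ≡ edgeIn a b (y ∷ ys)
    skip y ys ℓx≡i = cong₂ (λ c e → ((c ∧ eqF y b) ∨ (e ∧ eqF y a)) ∨ edgeIn a b (y ∷ ys))
      (⌊≟⌋-false {x = x} {a} λ { refl → m≢1+n+m i (trans (sym ℓx≡i) ℓa≡) })
      (⌊≟⌋-false {x = x} {b} λ { refl → m≢1+n+m i (trans (sym ℓx≡i) (trans ℓb≡ (cong suc ℓa≡))) })

  walksFrom-offLayer : ∀ i x len Q → ¬ ℓ x ≡ i → walksFrom i x len Q ≡ 0
  walksFrom-offLayer i x len Q ℓx≢i =
    trans (walksFrom-cong i x len Q (λ _ → false) (λ xs td → ⊥-elim (ℓx≢i (td-head i x xs td))))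
          (walksFrom-false i x len)

  count≡∑walks : ∀ Q → length (filter (λ p → Q p ≟ᵇ true) topDownPaths) ≡ ∑[ x < n ] walksFrom 0 x h Q
  count≡∑walks Q = begin
    length (filter (λ p → Q p ≟ᵇ true) topDownPaths)
      ≡⟨ length-filter Q topDownPaths ⟩
    listSum (map (λ p → ⟦ Q p ⟧) topDownPaths)
      ≡⟨ sum-map-filter isTopDown (λ p → ⟦ Q p ⟧) (allVecs (suc h)) ⟩
    listSum (map (λ p → ⟦ isTopDown p ⟧ * ⟦ Q p ⟧) (allVecs (suc h)))
      ≡⟨ cong listSum (map-cong (λ p → ⟦∧⟧ (isTopDown p) (Q p)) (allVecs (suc h))) ⟨
    listSum (map (λ p → ⟦ isTopDown p ∧ Q p ⟧) (allVecs (suc h)))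
      ≡⟨ sum-allVecs-suc h _ ⟩
    ∑[ x < n ] walksFrom 0 x h Q ∎
    where open ≡-Reasoning

  countNode≡up*down : ∀ v → countNode v ≡ up v * down v
  countNode≡up*down v = begin
    countNode v
      ≡⟨ count≡∑walks (nodeIn v) ⟩
    ∑[ x < n ] walksFrom 0 x h (nodeIn v)
      ≡⟨ sum-cong-≗ (λ x → walksFrom-nodeIn (ℓ v) 0 x h v (sym (+-identityʳ _)) (ℓ≤h v)) ⟩
    ∑[ x < n ] (walksBetween 0 (ℓ v) x v * down v)
      ≡⟨ *-distribʳ-sum (down v) (λ x → walksBetween 0 (ℓ v) x v) ⟨
    (∑[ x < n ] walksBetween 0 (ℓ v) x v) * down v
      ≡⟨ cong (_* down v) (up≡∑walksBetween v) ⟨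
    up v * down v ∎
    where open ≡-Reasoning

  countEdge≡up*down : ∀ a b → adj a b ≡ true → ℓ b ≡ suc (ℓ a) → countEdge a b ≡ up a * down b
  countEdge≡up*down a b ab ℓb≡ = begin
    countEdge a b
      ≡⟨ count≡∑walks (edgeIn a b) ⟩
    ∑[ x < n ] walksFrom 0 x h (edgeIn a b)
      ≡⟨ sum-cong-≗ (λ x → walksFrom-edgeIn (ℓ a) 0 x h a b ab ℓb≡ (sym (+-identityʳ _)) ℓa<h) ⟩
    ∑[ x < n ] (walksBetween 0 (ℓ a) x a * pathsFrom (ℓ b) b (h ∸ suc (ℓ a)))
      ≡⟨ *-distribʳ-sum _ (λ x → walksBetween 0 (ℓ a) x a) ⟨
    (∑[ x < n ] walksBetween 0 (ℓ a) x a) * pathsFrom (ℓ b) b (h ∸ suc (ℓ a))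
      ≡⟨ cong₂ _*_ (up≡∑walksBetween a) (cong (λ j → pathsFrom (ℓ b) b (h ∸ j)) ℓb≡) ⟨
    up a * down b ∎
    where
    open ≡-Reasoning
    ℓa<h : ℓ a < h
    ℓa<h = subst (_≤ h) ℓb≡ (ℓ≤h b)

  countEdge-sym : ∀ a b → countEdge a b ≡ countEdge b a
  countEdge-sym a b = trans (length-filter (edgeIn a b) topDownPaths) (trans
    (cong listSum (map-cong (λ p → cong ⟦_⟧ (edgeIn-sym p)) topDownPaths))
    (sym (length-filter (edgeIn b a) topDownPaths)))
    where
    edgeIn-sym : ∀ {len} (p : Vec (Fin n) len) → edgeIn a b p ≡ edgeIn b a p
    edgeIn-sym [] = refl
    edgeIn-sym (x ∷ []) = refl
    edgeIn-sym (x ∷ y ∷ ys) = cong₂ _∨_ (∨-comm (eqF x a ∧ eqF y b) _) (edgeIn-sym (y ∷ ys))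

  up-first : ∀ v → ℓ v ≡ 0 → up v ≡ 1
  up-first v ℓv≡0 = trans (cong (λ m → pathsTo m v) ℓv≡0) (cong ⟦_⟧ (≡ᵇ-true ℓv≡0))

  up-rec : ∀ v m → ℓ v ≡ suc m → up v ≡ ∑[ u < n ] (⟦ adj v u ⟧ * (⟦ suc (ℓ u) ≡ᵇ suc m ⟧ * up u))
  up-rec v m ℓv≡ = trans (cong (λ j → pathsTo j v) ℓv≡) (sum-cong-≗ term)
    where
    term : ∀ u → pathsTo m u * step m u v ≡ ⟦ adj v u ⟧ * (⟦ suc (ℓ u) ≡ᵇ suc m ⟧ * up u)
    term u with ℓ u ≟ m
    ... | yes refl rewrite ≡ᵇ-true {ℓ u} refl | adj-sym u v =
      trans (*-comm (up u) _) (cong (⟦ adj v u ⟧ *_) (sym (+-identityʳ (up u))))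
    ... | no ℓu≢m rewrite ≡ᵇ-false ℓu≢m =
      trans (*-zeroʳ (pathsTo m u)) (sym (*-zeroʳ ⟦ adj v u ⟧))

  down-last : ∀ v → ℓ v ≡ h → down v ≡ 1
  down-last v ℓv≡h = begin
    pathsFrom (ℓ v) v (h ∸ ℓ v)  ≡⟨ cong (pathsFrom (ℓ v) v) (trans (cong (h ∸_) ℓv≡h) (n∸n≡0 h)) ⟩
    pathsFrom (ℓ v) v 0          ≡⟨ walksFrom-zero (ℓ v) v (λ _ → true) ⟩
    ⟦ (ℓ v ≡ᵇ ℓ v) ∧ true ⟧      ≡⟨ cong (λ c → ⟦ c ∧ true ⟧) (≡ᵇ-true {ℓ v} refl) ⟩
    1                             ∎
    where open ≡-Reasoning

  down-rec : ∀ v → ℓ v < h → down v ≡ ∑[ u < n ] (⟦ adj v u ⟧ * (⟦ ℓ u ≡ᵇ suc (ℓ v) ⟧ * down u))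
  down-rec v ℓv<h = begin
    pathsFrom (ℓ v) v (h ∸ ℓ v)
      ≡⟨ cong (pathsFrom (ℓ v) v) (+-∸-assoc 1 ℓv<h) ⟩
    pathsFrom (ℓ v) v (suc (h ∸ suc (ℓ v)))
      ≡⟨ walksFrom-suc (ℓ v) v (h ∸ suc (ℓ v)) (λ _ → true) ⟩
    ∑[ u < n ] (step (ℓ v) v u * pathsFrom (suc (ℓ v)) u (h ∸ suc (ℓ v)))
      ≡⟨ sum-cong-≗ term ⟩
    ∑[ u < n ] (⟦ adj v u ⟧ * (⟦ ℓ u ≡ᵇ suc (ℓ v) ⟧ * down u)) ∎
    where
    open ≡-Reasoning
    term : ∀ u → step (ℓ v) v u * pathsFrom (suc (ℓ v)) u (h ∸ suc (ℓ v))
                 ≡ ⟦ adj v u ⟧ * (⟦ ℓ u ≡ᵇ suc (ℓ v) ⟧ * down u)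
    term u with ℓ u ≟ suc (ℓ v)
    ... | yes ℓu≡ rewrite ≡ᵇ-true {ℓ v} refl | ≡ᵇ-true ℓu≡ =
      cong (⟦ adj v u ⟧ *_) (trans (cong₂ (λ i j → pathsFrom i u (h ∸ j)) (sym ℓu≡) (sym ℓu≡))
                                   (sym (+-identityʳ (down u))))
    ... | no ℓu≢ rewrite ≡ᵇ-false ℓu≢ =
      trans (cong (step (ℓ v) v u *_) (walksFrom-offLayer (suc (ℓ v)) u (h ∸ suc (ℓ v)) (λ _ → true) ℓu≢))
            (trans (*-zeroʳ (step (ℓ v) v u)) (sym (*-zeroʳ ⟦ adj v u ⟧)))

  pathsTo-≤ : ∀ m v → pathsTo m v ≤ n ^ m
  pathsTo-≤ zero v = ⟦⟧≤1 (ℓ v ≡ᵇ 0)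
  pathsTo-≤ (suc m) v = ∑-mono-≤ _ (λ u → begin
    pathsTo m u * step m u v ≤⟨ *-monoʳ-≤ (pathsTo m u) (⟦⟧≤1 _) ⟩
    pathsTo m u * 1          ≡⟨ *-identityʳ _ ⟩
    pathsTo m u              ≤⟨ pathsTo-≤ m u ⟩
    n ^ m                    ∎)
    where open ≤-Reasoning

  pathsFrom-≤ : ∀ i x len → pathsFrom i x len ≤ n ^ len
  pathsFrom-≤ i x zero = ≤-trans (≤-reflexive (walksFrom-zero i x (λ _ → true))) (⟦⟧≤1 _)
  pathsFrom-≤ i x (suc len) = ≤-trans (≤-reflexive (walksFrom-suc i x len (λ _ → true))) (∑-mono-≤ _ (λ y → begin
    step i x y * pathsFrom (suc i) y len ≤⟨ *-monoˡ-≤ _ (⟦⟧≤1 ((ℓ x ≡ᵇ i) ∧ adj x y)) ⟩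
    1 * pathsFrom (suc i) y len          ≡⟨ *-identityˡ _ ⟩
    pathsFrom (suc i) y len              ≤⟨ pathsFrom-≤ (suc i) y len ⟩
    n ^ len                              ∎))
    where open ≤-Reasoning

-- Fixed-width binary encoding

bits : ℕ → ℕ → List Bool
bits zero x = []
bits (suc m) x = (x % 2 ≡ᵇ 1) ∷ bits m (x / 2)

fromBits : List Bool → ℕ
fromBits [] = 0
fromBits (b ∷ bs) = ⟦ b ⟧ + 2 * fromBits bs

length-bits : ∀ m x → length (bits m x) ≡ m
length-bits zero x = refl
length-bits (suc m) x = cong suc (length-bits m (x / 2))

fromBits-bits : ∀ m x → x < 2 ^ m → fromBits (bits m x) ≡ x
fromBits-bits zero zero _ = refl
fromBits-bits zero (suc x) (s≤s ())
fromBits-bits (suc m) x x<2^1+m = begin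
  ⟦ x % 2 ≡ᵇ 1 ⟧ + 2 * fromBits (bits m (x / 2))
    ≡⟨ cong₂ _+_ (lowBit (x % 2) (m%n<n x 2)) (cong (2 *_) (fromBits-bits m (x / 2) x/2<2^m)) ⟩
  x % 2 + 2 * (x / 2) ≡⟨ cong (x % 2 +_) (*-comm 2 (x / 2)) ⟩
  x % 2 + x / 2 * 2   ≡⟨ m≡m%n+[m/n]*n x 2 ⟨
  x                   ∎
  where
  open ≡-Reasoning
  lowBit : ∀ r → r < 2 → ⟦ r ≡ᵇ 1 ⟧ ≡ r
  lowBit zero _ = refl
  lowBit (suc zero) _ = refl
  lowBit (suc (suc r)) (s≤s (s≤s ()))
  x/2<2^m : x / 2 < 2 ^ m
  x/2<2^m = m<n*o⇒m/o<n (subst (x <_) (*-comm 2 (2 ^ m)) x<2^1+m)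

take-length-++ : ∀ {A : Set} (xs ys : List A) → take (length xs) (xs ++ ys) ≡ xs
take-length-++ [] ys = refl
take-length-++ (x ∷ xs) ys = cong (x ∷_) (take-length-++ xs ys)

drop-length-++ : ∀ {A : Set} (xs ys : List A) → drop (length xs) (xs ++ ys) ≡ ys
drop-length-++ [] ys = refl
drop-length-++ (x ∷ xs) ys = drop-length-++ xs ys

take-++-take-drop : ∀ {A : Set} m k (xs : List A) → take m xs ++ take k (drop m xs) ≡ take (m + k) xs
take-++-take-drop zero k xs = refl
take-++-take-drop (suc m) zero [] = refl
take-++-take-drop (suc m) (suc k) [] = refl
take-++-take-drop (suc m) k (x ∷ xs) = cong (x ∷_) (take-++-take-drop m k xs)

encode : ℕ → ℕ × ℕ × ℕ → List Bool
encode m (a , b , c) = bits m a ++ bits m b ++ bits m c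

decode : ℕ → List Bool → ℕ × ℕ × ℕ
decode m xs = fromBits (take m xs) , fromBits (take m (drop m xs)) , fromBits (drop m (drop m xs))

length-encode : ∀ m r → length (encode m r) ≡ 3 * m
length-encode m (a , b , c) = begin
  length (bits m a ++ bits m b ++ bits m c)             ≡⟨ length-++ (bits m a) ⟩
  length (bits m a) + length (bits m b ++ bits m c)     ≡⟨ cong (length (bits m a) +_) (length-++ (bits m b)) ⟩
  length (bits m a) + (length (bits m b) + length (bits m c))
    ≡⟨ cong₂ _+_ (length-bits m a) (cong₂ _+_ (length-bits m b) (trans (length-bits m c) (sym (+-identityʳ m)))) ⟩
  3 * m ∎
  where open ≡-Reasoning

decode-++ : ∀ m xs ys zs → length xs ≡ m → length ys ≡ m →
  decode m (xs ++ ys ++ zs) ≡ (fromBits xs , fromBits ys , fromBits zs)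
decode-++ _ xs ys zs refl ys≡
  rewrite take-length-++ xs (ys ++ zs) | drop-length-++ xs (ys ++ zs) | sym ys≡ | take-length-++ ys zs | drop-length-++ ys zs = refl

decode-encode : ∀ m a b c → a < 2 ^ m → b < 2 ^ m → c < 2 ^ m → decode m (encode m (a , b , c)) ≡ (a , b , c)
decode-encode m a b c a< b< c< = begin
  decode m (bits m a ++ bits m b ++ bits m c)
    ≡⟨ decode-++ m (bits m a) (bits m b) (bits m c) (length-bits m a) (length-bits m b) ⟩
  fromBits (bits m a) , fromBits (bits m b) , fromBits (bits m c)
    ≡⟨ cong₂ _,_ (fromBits-bits m a a<) (cong₂ _,_ (fromBits-bits m b b<) (fromBits-bits m c c<)) ⟩
  a , b , c ∎
  where open ≡-Reasoning

n<2^suc⌊log₂n⌋ : ∀ n → n < 2 ^ suc ⌊log₂ n ⌋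
n<2^suc⌊log₂n⌋ n = ≰⇒> λ 2^≤n →
  1+n≰n (subst (_≤ ⌊log₂ n ⌋) (⌊log₂[2^n]⌋≡n (suc ⌊log₂ n ⌋)) (⌊log₂⌋-mono-≤ 2^≤n))

n<2^n : ∀ n → n < 2 ^ n
n<2^n zero = s≤s z≤n
n<2^n (suc n) = +-mono-≤ (m^n>0 2 n) (≤-trans (n<2^n n) (≤-reflexive (sym (+-identityʳ (2 ^ n)))))

-- The algorithm

-- A node's layer together with its current estimates of up and down.
Report : Set
Report = ℕ × ℕ × ℕ

upTerm : ℕ → Report → ℕ
upTerm l (l′ , w , _) = ⟦ suc l′ ≡ᵇ l ⟧ * w

downTerm : ℕ → Report → ℕ
downTerm l (l′ , _ , s) = ⟦ l′ ≡ᵇ suc l ⟧ * s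

estimate : (myLayer layers : ℕ) → ((Report → ℕ) → ℕ) → ℕ × ℕ
estimate l L nbrSum = (if l ≡ᵇ 0 then 1 else nbrSum (upTerm l)) , (if suc l ≡ᵇ L then 1 else nbrSum (downTerm l))

estimate-cong : ∀ l L {Σ₁ Σ₂ : (Report → ℕ) → ℕ} → (∀ f → Σ₁ f ≡ Σ₂ f) →
  estimate l L Σ₁ ≡ estimate l L Σ₂
estimate-cong l L eq = cong₂ _,_ (cong (if l ≡ᵇ 0 then 1 else_) (eq (upTerm l)))
                                 (cong (if suc l ≡ᵇ L then 1 else_) (eq (downTerm l)))

record Config : Set where
  field
    width layers myLayer : ℕ
    nbrIds : List ℕ

open Config

record NodeState : Set where
  field
    config : Config
    round  : ℕ
    heard  : ℕ → Report
    buffer : ℕ → List Bool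

open NodeState

estimateFrom : Config → (ℕ → Report) → ℕ × ℕ
estimateFrom c reports = estimate (myLayer c) (layers c) (λ f → listSum (map (λ i → f (reports i)) (nbrIds c)))

chunk : Config → List Bool → ℕ → List Bool
chunk c bs j = take (3 * width c) (drop (j * (3 * width c)) bs)

message : Config → (ℕ → Report) → List Bool
message c reports = encode (layers c * width c) (myLayer c , estimateFrom c reports)

nodeValue : ℕ × ℕ → ℕ
nodeValue (w , d) = w * d

edgeValue : ℕ → ℕ × ℕ → Report → ℕ
edgeValue l (w , d) (l′ , w′ , d′) = if l′ ≡ᵇ suc l then w * d′ else w′ * d

advance : Bool → NodeState → (ℕ → List Bool) → NodeState
advance false s inbox = record s { round = suc (round s) ; buffer = λ i → buffer s i ++ inbox i }
advance true s inbox = record s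
  { round = 0
  ; heard = λ i → decode (layers (config s) * width (config s)) (buffer s i ++ inbox i)
  ; buffer = λ _ → []
  }

-- In the j-th round of a phase a node sends the j-th chunk of its encoded report; in the last
-- round it decodes the reports its neighbours sent during the phase.
pathCounting : Algorithm
pathCounting = record
  { State = NodeState
  ; init = λ n L _ l ids → record
      { config = record { width = suc ⌊log₂ n ⌋ ; layers = L ; myLayer = l ; nbrIds = ids }
      ; round = 0
      ; heard = λ _ → (0 , 0 , 0)
      ; buffer = λ _ → []
      }
  ; send = λ s _ → chunk (config s) (message (config s) (heard s)) (round s)
  ; receive = λ s → advance (suc (round s) ≡ᵇ layers (config s)) s
  ; outNode = λ s → nodeValue (estimateFrom (config s) (heard s))
  ; outEdge = λ s i → edgeValue (myLayer (config s)) (estimateFrom (config s) (heard s)) (heard s i)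
  }

-- What is known after each phase

module Phases {n : ℕ} (G : SimpleGraph n) {h : ℕ} (layer : Fin n → Fin (suc h)) where
  open SimpleGraph G using (adj)
  open Walks G layer

  -- Estimates of nodes not yet reached are exactly 0, not stale; this keeps every transmitted
  -- number below n ^ h.
  known : ℕ → Fin n → ℕ × ℕ
  known p v = (if ℓ v ≤ᵇ p then up v else 0) , (if h ≤ᵇ ℓ v + p then down v else 0)

  report : ℕ → Fin n → Report
  report zero u = 0 , 0 , 0
  report (suc p) u = ℓ u , known p u

  nbrSum : Fin n → (Fin n → Report) → (Report → ℕ) → ℕ
  nbrSum v r f = ∑[ u < n ] (⟦ adj v u ⟧ * f (r u))

  ∑-guard-cong : ∀ v (c : Fin n → Bool) {X Y : Fin n → ℕ} → (∀ u → c u ≡ true → X u ≡ Y u) →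
    ∑[ u < n ] (⟦ adj v u ⟧ * (⟦ c u ⟧ * X u)) ≡ ∑[ u < n ] (⟦ adj v u ⟧ * (⟦ c u ⟧ * Y u))
  ∑-guard-cong v c eq = sum-cong-≗ (λ u → cong (⟦ adj v u ⟧ *_) (guard-cong (c u) (eq u)))

  ∑-guard-zero : ∀ v (c : Fin n → Bool) → ∑[ u < n ] (⟦ adj v u ⟧ * (⟦ c u ⟧ * 0)) ≡ 0
  ∑-guard-zero v c = ∑-zero _ (λ u → trans (cong (⟦ adj v u ⟧ *_) (*-zeroʳ ⟦ c u ⟧)) (*-zeroʳ ⟦ adj v u ⟧))

  up-phase : ∀ p v → (if ℓ v ≡ᵇ 0 then 1 else nbrSum v (report p) (upTerm (ℓ v))) ≡ proj₁ (known p v)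
  up-phase p v = byLayer (ℓ v) refl
    where
    open ≡-Reasoning
    byLayer : ∀ l → ℓ v ≡ l → (if ℓ v ≡ᵇ 0 then 1 else nbrSum v (report p) (upTerm (ℓ v))) ≡ proj₁ (known p v)
    byLayer zero ℓv≡0 = begin
      (if ℓ v ≡ᵇ 0 then 1 else nbrSum v (report p) (upTerm (ℓ v)))
        ≡⟨ cong (if_then 1 else nbrSum v (report p) (upTerm (ℓ v))) (≡ᵇ-true ℓv≡0) ⟩
      1 ≡⟨ up-first v ℓv≡0 ⟨
      up v ≡⟨ cong (if_then up v else 0) (≤ᵇ-true (≤-trans (≤-reflexive ℓv≡0) z≤n)) ⟨
      proj₁ (known p v) ∎
    byLayer (suc m) ℓv≡ = begin
      (if ℓ v ≡ᵇ 0 then 1 else nbrSum v (report p) (upTerm (ℓ v)))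
        ≡⟨ cong₂ (λ b l → if b then 1 else nbrSum v (report p) (upTerm l))
                 (≡ᵇ-false (λ e → 0≢1+n (trans (sym e) ℓv≡))) ℓv≡ ⟩
      nbrSum v (report p) (upTerm (suc m))
        ≡⟨ from p ⟩
      (if suc m ≤ᵇ p then up v else 0)
        ≡⟨ cong (λ l → if l ≤ᵇ p then up v else 0) ℓv≡ ⟨
      proj₁ (known p v) ∎
      where
      ℓu≡m : ∀ u → (suc (ℓ u) ≡ᵇ suc m) ≡ true → ℓ u ≡ m
      ℓu≡m u e = ≡ᵇ⇒≡ (ℓ u) m (subst T (sym e) _)
      from : ∀ p → nbrSum v (report p) (upTerm (suc m)) ≡ (if suc m ≤ᵇ p then up v else 0)
      from zero = ∑-guard-zero v (λ u → 1 ≡ᵇ suc m)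
      from (suc p) with m ≤? p
      ... | yes m≤p = begin
        nbrSum v (report (suc p)) (upTerm (suc m))
          ≡⟨ ∑-guard-cong v (λ u → suc (ℓ u) ≡ᵇ suc m) (λ u e →
               cong (if_then up u else 0) (≤ᵇ-true (≤-trans (≤-reflexive (ℓu≡m u e)) m≤p))) ⟩
        ∑[ u < n ] (⟦ adj v u ⟧ * (⟦ suc (ℓ u) ≡ᵇ suc m ⟧ * up u))
          ≡⟨ up-rec v m ℓv≡ ⟨
        up v
          ≡⟨ cong (if_then up v else 0) (≤ᵇ-true (s≤s m≤p)) ⟨
        (if suc m ≤ᵇ suc p then up v else 0) ∎
        where open ≡-Reasoning
      ... | no m≰p = begin
        nbrSum v (report (suc p)) (upTerm (suc m))
          ≡⟨ ∑-guard-cong v (λ u → suc (ℓ u) ≡ᵇ suc m) (λ u e →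
               cong (if_then up u else 0) (≤ᵇ-false λ ℓu≤p → m≰p (subst (_≤ p) (ℓu≡m u e) ℓu≤p))) ⟩
        ∑[ u < n ] (⟦ adj v u ⟧ * (⟦ suc (ℓ u) ≡ᵇ suc m ⟧ * 0))
          ≡⟨ ∑-guard-zero v (λ u → suc (ℓ u) ≡ᵇ suc m) ⟩
        0
          ≡⟨ cong (if_then up v else 0) (≤ᵇ-false (λ 1+m≤1+p → m≰p (≤-pred 1+m≤1+p))) ⟨
        (if suc m ≤ᵇ suc p then up v else 0) ∎
        where open ≡-Reasoning

  down-phase : ∀ p v → (if suc (ℓ v) ≡ᵇ suc h then 1 else nbrSum v (report p) (downTerm (ℓ v))) ≡ proj₂ (known p v)
  down-phase p v with ℓ v ≟ h
  ... | yes ℓv≡h = begin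
    (if suc (ℓ v) ≡ᵇ suc h then 1 else nbrSum v (report p) (downTerm (ℓ v)))
      ≡⟨ cong (if_then 1 else nbrSum v (report p) (downTerm (ℓ v))) (≡ᵇ-true (cong suc ℓv≡h)) ⟩
    1 ≡⟨ down-last v ℓv≡h ⟨
    down v ≡⟨ cong (if_then down v else 0) (≤ᵇ-true (≤-trans (≤-reflexive (sym ℓv≡h)) (m≤m+n (ℓ v) p))) ⟨
    proj₂ (known p v) ∎
    where open ≡-Reasoning
  ... | no ℓv≢h = begin
    (if suc (ℓ v) ≡ᵇ suc h then 1 else nbrSum v (report p) (downTerm (ℓ v)))
      ≡⟨ cong (if_then 1 else nbrSum v (report p) (downTerm (ℓ v))) (≡ᵇ-false (λ e → ℓv≢h (suc-injective e))) ⟩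
    nbrSum v (report p) (downTerm (ℓ v)) ≡⟨ from p ⟩
    proj₂ (known p v) ∎
    where
    open ≡-Reasoning
    ℓv<h : ℓ v < h
    ℓv<h = ≤∧≢⇒< (ℓ≤h v) ℓv≢h
    ℓu≡ : ∀ q u → (ℓ u ≡ᵇ suc (ℓ v)) ≡ true → ℓ u + q ≡ ℓ v + suc q
    ℓu≡ q u e = trans (cong (_+ q) (≡ᵇ⇒≡ (ℓ u) (suc (ℓ v)) (subst T (sym e) _))) (sym (+-suc (ℓ v) q))
    from : ∀ p → nbrSum v (report p) (downTerm (ℓ v)) ≡ (if h ≤ᵇ ℓ v + p then down v else 0)
    from zero = begin
      ∑[ u < n ] (⟦ adj v u ⟧ * (⟦ 0 ≡ᵇ suc (ℓ v) ⟧ * 0)) ≡⟨ ∑-guard-zero v (λ u → 0 ≡ᵇ suc (ℓ v)) ⟩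
      0 ≡⟨ cong (if_then down v else 0) (≤ᵇ-false (λ le → <⇒≱ ℓv<h (subst (h ≤_) (+-identityʳ (ℓ v)) le))) ⟨
      (if h ≤ᵇ ℓ v + 0 then down v else 0) ∎
    from (suc p) with h ≤? ℓ v + suc p
    ... | yes le = begin
      nbrSum v (report (suc p)) (downTerm (ℓ v))
        ≡⟨ ∑-guard-cong v (λ u → ℓ u ≡ᵇ suc (ℓ v)) (λ u e →
             cong (if_then down u else 0) (≤ᵇ-true (subst (h ≤_) (sym (ℓu≡ p u e)) le))) ⟩
      ∑[ u < n ] (⟦ adj v u ⟧ * (⟦ ℓ u ≡ᵇ suc (ℓ v) ⟧ * down u))
        ≡⟨ down-rec v ℓv<h ⟨
      down v ≡⟨ cong (if_then down v else 0) (≤ᵇ-true le) ⟨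
      (if h ≤ᵇ ℓ v + suc p then down v else 0) ∎
    ... | no nle = begin
      nbrSum v (report (suc p)) (downTerm (ℓ v))
        ≡⟨ ∑-guard-cong v (λ u → ℓ u ≡ᵇ suc (ℓ v)) (λ u e →
             cong (if_then down u else 0) (≤ᵇ-false λ le → nle (subst (h ≤_) (ℓu≡ p u e) le))) ⟩
      ∑[ u < n ] (⟦ adj v u ⟧ * (⟦ ℓ u ≡ᵇ suc (ℓ v) ⟧ * 0))
        ≡⟨ ∑-guard-zero v (λ u → ℓ u ≡ᵇ suc (ℓ v)) ⟩
      0 ≡⟨ cong (if_then down v else 0) (≤ᵇ-false nle) ⟨
      (if h ≤ᵇ ℓ v + suc p then down v else 0) ∎

  estimate-report : ∀ p v → estimate (ℓ v) (suc h) (nbrSum v (report p)) ≡ known p v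
  estimate-report p v = cong₂ _,_ (up-phase p v) (down-phase p v)

module Execution {n : ℕ} (G : SimpleGraph n) {h : ℕ} (layer : Fin n → Fin (suc h))
                 (ident : Fin n → ℕ) (ident-injective : Injective _≡_ _≡_ ident) where
  open SimpleGraph G using (adj) renaming (sym to adj-sym)
  open Paths G layer using (countNode; countEdge)
  open Walks G layer
  open Phases G layer
  open Run pathCounting G (suc h) layer ident (bandwidth 3 n)

  w : ℕ
  w = suc ⌊log₂ n ⌋

  M : ℕ
  M = suc h * w

  configOf : Fin n → Config
  configOf v = record { width = w ; layers = suc h ; myLayer = ℓ v ; nbrIds = map ident (neighbours v) }

  -- The inbox that Run.state builds in its where block, which cannot be referred to by name.
  inbox : ℕ → Fin n → ℕ → List Bool
  inbox t v j = concat (map (λ u → if ident u ≡ᵇ j then take (3 * w) (Algorithm.send pathCounting (state t u) (ident v)) else [])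
                            (neighbours v))

  config-state : ∀ t v → config (state t v) ≡ configOf v
  config-state zero v = refl
  config-state (suc t) v =
    trans (config-advance (suc (round (state t v)) ≡ᵇ layers (config (state t v))) (state t v) (inbox t v))
          (config-state t v)
    where
    config-advance : ∀ b s inbox → config (advance b s inbox) ≡ config s
    config-advance false s inbox = refl
    config-advance true s inbox = refl

  inbox-from : ∀ t v u → adj v u ≡ true → inbox t v (ident u) ≡ take (3 * w) (Algorithm.send pathCounting (state t u) (ident v))
  inbox-from t v u vu = begin
    inbox t v (ident u)
      ≡⟨ concat-map-filter (adj v) (λ u′ → if ident u′ ≡ᵇ ident u then X u′ else []) (allFin n) ⟩
    concat (map (λ u′ → if adj v u′ then (if ident u′ ≡ᵇ ident u then X u′ else []) else []) (allFin n))
      ≡⟨ concat-map-tabulate-single _ (λ i → i) u off ⟩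
    (if adj v u then (if ident u ≡ᵇ ident u then X u else []) else [])
      ≡⟨ cong₂ (λ a e → if a then (if e then X u else []) else []) vu (≡ᵇ-true {ident u} refl) ⟩
    X u ∎
    where
    open ≡-Reasoning
    X : Fin n → List Bool
    X u′ = take (3 * w) (Algorithm.send pathCounting (state t u′) (ident v))
    off : ∀ u′ → ¬ u′ ≡ u → (if adj v u′ then (if ident u′ ≡ᵇ ident u then X u′ else []) else []) ≡ []
    off u′ u′≢u rewrite ≡ᵇ-false (λ e → u′≢u (ident-injective e)) with adj v u′
    ... | true = refl
    ... | false = refl

  sum-neighbours : ∀ v (g : ℕ → ℕ) (r : Fin n → ℕ) → (∀ u → adj v u ≡ true → g (ident u) ≡ r u) →
    listSum (map g (map ident (neighbours v))) ≡ ∑[ u < n ] (⟦ adj v u ⟧ * r u)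
  sum-neighbours v g r eq = begin
    listSum (map g (map ident (neighbours v)))                 ≡⟨ cong listSum (map-∘ (neighbours v)) ⟨
    listSum (map (λ u → g (ident u)) (neighbours v))           ≡⟨ sum-map-filter (adj v) (λ u → g (ident u)) (allFin n) ⟩
    listSum (map (λ u → ⟦ adj v u ⟧ * g (ident u)) (allFin n)) ≡⟨ sum-map-allFin (λ u → ⟦ adj v u ⟧ * g (ident u)) ⟩
    ∑[ u < n ] (⟦ adj v u ⟧ * g (ident u))                     ≡⟨ sum-cong-≗ (λ u → guard-cong (adj v u) (eq u)) ⟩
    ∑[ u < n ] (⟦ adj v u ⟧ * r u)                             ∎
    where open ≡-Reasoning

  message-of : ℕ → Fin n → List Bool
  message-of p u = encode M (ℓ u , known p u)

  record Synchronised (p j : ℕ) (s : NodeState) (v : Fin n) : Set where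
    field
      round≡  : round s ≡ j
      heard≡  : ∀ u → adj v u ≡ true → heard s (ident u) ≡ report p u
      buffer≡ : ∀ u → adj v u ≡ true → buffer s (ident u) ≡ take (j * (3 * w)) (message-of p u)

  open Synchronised

  estimate-synchronised : ∀ {p j s} v → Synchronised p j s v → estimateFrom (configOf v) (heard s) ≡ known p v
  estimate-synchronised {p} {s = s} v sync =
    trans (estimate-cong (ℓ v) (suc h) (λ f → sum-neighbours v (λ i → f (heard s i)) (λ u → f (report p u))
                                                 (λ u vu → cong f (heard≡ sync u vu))))
          (estimate-report p v)

  send-synchronised : ∀ p j t u x → Synchronised p j (state t u) u →
    Algorithm.send pathCounting (state t u) x ≡ take (3 * w) (drop (j * (3 * w)) (message-of p u))
  send-synchronised p j t u x sync = begin
    chunk (config s) (message (config s) (heard s)) (round s)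
      ≡⟨ cong (λ c → chunk c (message c (heard s)) (round s)) (config-state t u) ⟩
    chunk (configOf u) (encode M (ℓ u , estimateFrom (configOf u) (heard s))) (round s)
      ≡⟨ cong₂ (λ e j → chunk (configOf u) (encode M (ℓ u , e)) j) (estimate-synchronised u sync) (round≡ sync) ⟩
    take (3 * w) (drop (j * (3 * w)) (message-of p u)) ∎
    where
    open ≡-Reasoning
    s = state t u

  Invariant : ℕ → ℕ → Set
  Invariant p j = ∀ v → Synchronised p j (state (j + p * suc h) v) v

  received : ∀ p j → Invariant p j → ∀ v u → adj v u ≡ true →
    buffer (state (j + p * suc h) v) (ident u) ++ inbox (j + p * suc h) v (ident u) ≡ take (suc j * (3 * w)) (message-of p u)
  received p j inv v u vu = begin
    buffer (state t v) (ident u) ++ inbox t v (ident u)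
      ≡⟨ cong₂ _++_ (buffer≡ (inv v) u vu) (inbox-from t v u vu) ⟩
    take (j * B) e ++ take B (Algorithm.send pathCounting (state t u) (ident v))
      ≡⟨ cong (λ c → take (j * B) e ++ take B c) (send-synchronised p j t u (ident v) (inv u)) ⟩
    take (j * B) e ++ take B (take B (drop (j * B) e))
      ≡⟨ cong (take (j * B) e ++_) (trans (take-take B B _) (cong (λ m → take m (drop (j * B) e)) (⊓-idem B))) ⟩
    take (j * B) e ++ take B (drop (j * B) e)
      ≡⟨ take-++-take-drop (j * B) B e ⟩
    take (j * B + B) e
      ≡⟨ cong (λ m → take m e) (+-comm (j * B) B) ⟩
    take (suc j * B) e ∎
    where
    open ≡-Reasoning
    t = j + p * suc h
    B = 3 * w
    e = message-of p u

  invariant-start : Invariant 0 0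
  invariant-start v = record { round≡ = refl ; heard≡ = λ _ _ → refl ; buffer≡ = λ _ _ → refl }

  invariant-round : ∀ p j → j < h → Invariant p j → Invariant p (suc j)
  invariant-round p j j<h inv v = subst (λ s → Synchronised p (suc j) s v) (sym continues) record
    { round≡ = cong suc (round≡ (inv v))
    ; heard≡ = heard≡ (inv v)
    ; buffer≡ = received p j inv v
    }
    where
    t = j + p * suc h
    s = state t v
    continues : state (suc t) v ≡ advance false s (inbox t v)
    continues = cong (λ b → advance b s (inbox t v))
      (trans (cong₂ (λ r L → suc r ≡ᵇ L) (round≡ (inv v)) (cong layers (config-state t v)))
             (≡ᵇ-false (λ e → <⇒≢ j<h (suc-injective e))))

  fits : ∀ {x e} → x ≤ n ^ e → e ≤ h → x < 2 ^ M
  fits {x} {e} x≤ e≤h = begin-strict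
    x               ≤⟨ x≤ ⟩
    n ^ e           ≤⟨ ^-monoˡ-≤ e (<⇒≤ (n<2^suc⌊log₂n⌋ n)) ⟩
    (2 ^ w) ^ e     <⟨ ^-monoʳ-< (2 ^ w) (*-monoʳ-≤ 2 (m^n>0 2 ⌊log₂ n ⌋)) (s≤s e≤h) ⟩
    (2 ^ w) ^ suc h ≡⟨ ^-*-assoc 2 w (suc h) ⟩
    2 ^ (w * suc h) ≡⟨ cong (2 ^_) (*-comm w (suc h)) ⟩
    2 ^ M           ∎
    where open ≤-Reasoning

  layer-fits : ∀ u → ℓ u < 2 ^ M
  layer-fits u = begin-strict
    ℓ u        <⟨ s≤s (ℓ≤h u) ⟩
    suc h      <⟨ n<2^n (suc h) ⟩
    2 ^ suc h  ≤⟨ ^-monoʳ-≤ 2 (m≤m*n (suc h) w) ⟩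
    2 ^ M      ∎
    where open ≤-Reasoning

  if≤ : ∀ b x → (if b then x else 0) ≤ x
  if≤ true x = ≤-refl
  if≤ false x = z≤n

  message-decodes : ∀ p u → decode M (message-of p u) ≡ report (suc p) u
  message-decodes p u = decode-encode M (ℓ u) _ _ (layer-fits u)
    (fits (≤-trans (if≤ (ℓ u ≤ᵇ p) (up u)) (pathsTo-≤ (ℓ u) u)) (ℓ≤h u))
    (fits (≤-trans (if≤ (h ≤ᵇ ℓ u + p) (down u)) (pathsFrom-≤ (ℓ u) u (h ∸ ℓ u))) (m∸n≤m h (ℓ u)))

  invariant-phase : ∀ p → Invariant p h → Invariant (suc p) 0
  invariant-phase p inv v = subst (λ s → Synchronised (suc p) 0 s v) (sym ends) record
    { round≡ = refl
    ; heard≡ = completed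
    ; buffer≡ = λ _ _ → refl
    }
    where
    open ≡-Reasoning
    t = h + p * suc h
    s = state t v
    ends : state (suc t) v ≡ advance true s (inbox t v)
    ends = cong (λ b → advance b s (inbox t v))
      (trans (cong₂ (λ r L → suc r ≡ᵇ L) (round≡ (inv v)) (cong layers (config-state t v))) (≡ᵇ-true {suc h} refl))
    completed : ∀ u → adj v u ≡ true →
      decode (layers (config s) * width (config s)) (buffer s (ident u) ++ inbox t v (ident u)) ≡ report (suc p) u
    completed u vu = begin
      decode (layers (config s) * width (config s)) (buffer s (ident u) ++ inbox t v (ident u))
        ≡⟨ cong₂ decode (cong (λ c → layers c * width c) (config-state t v)) (received p h inv v u vu) ⟩
      decode M (take (suc h * (3 * w)) (message-of p u))
        ≡⟨ cong (decode M) (take-all _ (message-of p u) (≤-reflexive whole)) ⟩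
      decode M (message-of p u)
        ≡⟨ message-decodes p u ⟩
      report (suc p) u ∎
      where
      whole : length (message-of p u) ≡ suc h * (3 * w)
      whole = begin
        length (message-of p u) ≡⟨ length-encode M (ℓ u , known p u) ⟩
        3 * (suc h * w)         ≡⟨ *-assoc 3 (suc h) w ⟨
        3 * suc h * w           ≡⟨ cong (_* w) (*-comm 3 (suc h)) ⟩
        suc h * 3 * w           ≡⟨ *-assoc (suc h) 3 w ⟩
        suc h * (3 * w)         ∎

  invariant : ∀ p j → j ≤ h → Invariant p j
  invariant zero zero _ = invariant-start
  invariant (suc p) zero _ = invariant-phase p (invariant p h ≤-refl)
  invariant p (suc j) j<h = invariant-round p j j<h (invariant p j (<⇒≤ j<h))

  known-complete : ∀ p v → h ≤ p → known p v ≡ (up v , down v)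
  known-complete p v h≤p = cong₂ _,_ (cong (if_then up v else 0) (≤ᵇ-true (≤-trans (ℓ≤h v) h≤p)))
                                      (cong (if_then down v else 0) (≤ᵇ-true (≤-trans h≤p (m≤n+m p (ℓ v)))))

  CorrectAt : ℕ → Set
  CorrectAt t = (∀ v → Algorithm.outNode pathCounting (state t v) ≡ countNode v)
            × (∀ v u → adj v u ≡ true → Algorithm.outEdge pathCounting (state t v) (ident u) ≡ countEdge v u)

  correct-after-phase : IsLayering G (suc h) layer → ∀ p j → j ≤ h → h < p → CorrectAt (j + p * suc h)
  correct-after-phase layering (suc q) j j≤h (s≤s h≤q) = node , edge
    where
    open ≡-Reasoning
    t = j + suc q * suc h
    sync = invariant (suc q) j j≤h
    estimate≡ : ∀ v → estimateFrom (config (state t v)) (heard (state t v)) ≡ (up v , down v)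
    estimate≡ v = trans (cong (λ c → estimateFrom c (heard (state t v))) (config-state t v))
                        (trans (estimate-synchronised v (sync v)) (known-complete (suc q) v (≤-trans h≤q (n≤1+n q))))
    node : ∀ v → nodeValue (estimateFrom (config (state t v)) (heard (state t v))) ≡ countNode v
    node v = trans (cong nodeValue (estimate≡ v)) (sym (countNode≡up*down v))
    byLayers : ∀ v u → adj v u ≡ true → (suc (ℓ v) ≡ ℓ u) ⊎ (suc (ℓ u) ≡ ℓ v) →
      (if ℓ u ≡ᵇ suc (ℓ v) then up v * down u else up u * down v) ≡ countEdge v u
    byLayers v u vu (inj₁ below) =
      trans (cong (if_then up v * down u else up u * down v) (≡ᵇ-true (sym below))) (sym (countEdge≡up*down v u vu (sym below)))
    byLayers v u vu (inj₂ above) =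
      trans (cong (if_then up v * down u else up u * down v)
                  (≡ᵇ-false (λ ℓu≡ → <-asym (≤-reflexive (sym ℓu≡)) (≤-reflexive above))))
            (sym (trans (countEdge-sym v u) (countEdge≡up*down u v (trans (adj-sym u v) vu) (sym above))))
    edge : ∀ v u → adj v u ≡ true →
      edgeValue (myLayer (config (state t v))) (estimateFrom (config (state t v)) (heard (state t v))) (heard (state t v) (ident u))
      ≡ countEdge v u
    edge v u vu = begin
      edgeValue (myLayer (config (state t v))) (estimateFrom (config (state t v)) (heard (state t v))) (heard (state t v) (ident u))
        ≡⟨ cong₂ (λ c e → edgeValue (myLayer c) e (heard (state t v) (ident u))) (config-state t v) (estimate≡ v) ⟩
      edgeValue (ℓ v) (up v , down v) (heard (state t v) (ident u))
        ≡⟨ cong (edgeValue (ℓ v) (up v , down v)) (trans (heard≡ (sync v) u vu) (cong (ℓ u ,_) (known-complete q u h≤q))) ⟩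
      edgeValue (ℓ v) (up v , down v) (ℓ u , up u , down u)
        ≡⟨ byLayers v u vu (layering v u vu) ⟩
      countEdge v u ∎

  correct : IsLayering G (suc h) layer → ∀ t → suc h * suc h ≤ t → CorrectAt t
  correct layering t L²≤t = subst CorrectAt (sym (m≡m%n+[m/n]*n t (suc h)))
    (correct-after-phase layering (t / suc h) (t % suc h) (≤-pred (m%n<n t (suc h)))
      (subst (_≤ t / suc h) (m*n/n≡m (suc h) (suc h)) (/-monoˡ-≤ (suc h) L²≤t)))

lemmaA4 : (cid : ℕ) →
  ∃ λ (cb : ℕ) → ∃ λ (cr : ℕ) → ∃ λ (A : Algorithm) →
    ∀ (n : ℕ) (G : SimpleGraph n) (L : ℕ) (layer : Fin n → Fin L) →
    IsLayering G L layer →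
    (ident : Fin n → ℕ) → Injective _≡_ _≡_ ident → (∀ v → ident v < suc n ^ cid) →
    let open Run A G L layer ident (bandwidth cb n)
        open Paths G layer
        R = cr * suc (L * L)
    in (∀ v → Algorithm.outNode A (state R v) ≡ countNode v)
       × (∀ v u → SimpleGraph.adj G v u ≡ true →
            Algorithm.outEdge A (state R v) (ident u) ≡ countEdge v u)
-- Identifiers are never transmitted.
lemmaA4 cid = 3 , 1 , pathCounting , λ where
  n G zero layer _ _ _ _ → (λ v → ⊥-elim (¬Fin0 (layer v))) , (λ v _ _ → ⊥-elim (¬Fin0 (layer v)))
  n G (suc h) layer layering ident injective _ →
    Execution.correct G layer ident injective layering (1 * suc (suc h * suc h))
      (≤-trans (n≤1+n _) (≤-reflexive (sym (*-identityˡ _))))
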